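{- Let $p\ge1$, $x=(x_1,\dots,x_p)$ and $a=(a_i)_{i\in\mathbb{Z}}$ a sequence of indeterminates. For every integer $k>p$, \[\det\big(h_{1+j-i}(x|\tau^{1-j}a)\big)_{1\le i,j\le k}=0\] in $\mathbb{Z}[a][x]$.
   Context: For a variable $y$, $(y|a)^k=(y-a_1)\cdots(y-a_k)$. For a partition $\lambda$ with at most $p$ parts, $s_\lambda(x|a)=\det[(x_j|a)^{\lambda_i+p-i}]_{1\le i,j\le p}/\det[(x_j|a)^{p-i}]_{1\le i,j\le p}$. $h_k(x|a)=s_{(k)}(x|a)$ for $k\ge0$ (so $h_0=1$) and $h_k(x|a)=0$ for $k<0$. For an integer $r$, $\tau^ra$ is the sequence whose $n$-th term is $a_{n+r}$. -}

module Defs where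

open import Level using (Level)
open import Algebra.Bundles using (CommutativeRing)
open import Data.Nat as ℕ using (ℕ; zero; suc)
open import Data.Integer as ℤ using (ℤ; +_; -[1+_])
open import Data.Fin using (Fin; zero; suc; toℕ; punchIn)

module _ {c ℓ : Level} (R : CommutativeRing c ℓ) where
  open CommutativeRing R using (Carrier; _+_; _*_; -_; _-_; 0#; 1#)

  ΣFin : (n : ℕ) → (Fin n → Carrier) → Carrier
  ΣFin zero    f = 0#
  ΣFin (suc n) f = f zero + ΣFin n (λ j → f (suc j))

  sgn : ℕ → Carrier
  sgn zero    = 1#
  sgn (suc m) = - sgn m

  det : (n : ℕ) → (Fin n → Fin n → Carrier) → Carrier
  det zero    M = 1#
  det (suc n) M =
    ΣFin (suc n) (λ j → sgn (toℕ j) * (M zero j * det n (λ i k → M (suc i) (punchIn j k))))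

  fpow : Carrier → (ℤ → Carrier) → ℕ → Carrier
  fpow y b zero    = 1#
  fpow y b (suc m) = fpow y b m * (y - b (+ suc m))

  τ : ℤ → (ℤ → Carrier) → (ℤ → Carrier)
  τ r b n = b (n ℤ.+ r)

  -- denominator det[(x_j|b)^{p-i}]_{1≤i,j≤p}   (rows indexed by i = 1+toℕ i')
  denom : (p : ℕ) → (Fin p → Carrier) → (ℤ → Carrier) → Carrier
  denom p x b = det p (λ i j → fpow (x j) b (p ℕ.∸ suc (toℕ i)))

  -- parts of the one-row partition (k): λ_1 = k, λ_i = 0 for i ≥ 2
  rowPart : ℕ → {p : ℕ} → Fin p → ℕ
  rowPart k zero    = k
  rowPart k (suc _) = 0

  -- numerator det[(x_j|b)^{λ_i+p-i}] for λ = (k)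
  numer : (p : ℕ) → ℕ → (Fin p → Carrier) → (ℤ → Carrier) → Carrier
  numer p k x b = det p (λ i j → fpow (x j) b (rowPart k i ℕ.+ (p ℕ.∸ suc (toℕ i))))

  hZ : (ℕ → (ℤ → Carrier) → Carrier) → ℤ → (ℤ → Carrier) → Carrier
  hZ H (+ k)     b = H k b
  hZ H -[1+ k ]  b = 0#

-- Fix a column c and put b = τ^(-c) a. Multiplying h_(1+c-i)(x|b) by the denominator det[(x_j|b)^(p-i)]
-- gives the same determinant with first row (x_j|b)^(c+p-i); when 1+c-i < 0 this row repeats a lower one,
-- matching h = 0. Expand ∏_l (y - x_l) = Σ_(m≤p) e_m (y|a)^m in the factorial basis. As
-- (y|b)^(c+m) = (y|b)^c (y|a)^m, the combination Σ_m e_m (x_j|b)^(c+m) vanishes, so by multilinearity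
-- and cancellation of the denominator Σ_m e_m h_(1+c-p+m)(x|b) = 0 in every column c. Thus rows 0, …, p
-- of the matrix satisfy a linear relation with coefficient e_p = 1 on row 0, and since k > p the
-- determinant vanishes. With det defined by expansion along the first row, "two equal rows give 0" comes
-- from expanding along the first two rows, where the column pairs (j, j′) and (j′, j) cancel.

module Submission where

open import Defs
open import Level using (Level)
open import Algebra.Bundles using (CommutativeRing)
open import Data.Nat as ℕ using (ℕ; zero; suc; _∸_; _≤_; _<_)
import Data.Nat.Properties as ℕP
open import Data.Integer as ℤ using (ℤ; +_; -[1+_])
import Data.Integer.Properties as ℤP
open import Data.Integer.Tactic.RingSolver using (solve-∀)
open import Data.Fin using (Fin; zero; suc; toℕ; punchIn; lift; fromℕ<; opposite)
open import Data.Fin.Properties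
  using (toℕ<n; toℕ-inject₁; toℕ-fromℕ; toℕ-fromℕ<; opposite-prop; opposite-involutive)
open import Data.Vec.Functional using (_∷_)
open import Function using (_∘_)
open import Relation.Binary.PropositionalEquality as ≡ using (_≡_; _≗_)
open import Relation.Nullary using (yes; no)

module Sums {c ℓ : Level} (R : CommutativeRing c ℓ) where
  open CommutativeRing R hiding (zero)
  open import Algebra.Properties.Ring ring using (-0#≈0#; -‿+-comm)
  open import Algebra.Properties.Semiring.Sum semiring public
    using (sum; sum-syntax; sum-cong-≋; sum-cong-≗; sum-init-last; sum-replicate-zero;
           ∑-distrib-+; ∑-comm; *-distribˡ-sum; *-distribʳ-sum)

  ΣFin≡sum : ∀ n (f : Fin n → Carrier) → ΣFin R n f ≡ sum f
  ΣFin≡sum zero    f = ≡.refl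
  ΣFin≡sum (suc n) f = ≡.cong (λ s → f zero + s) (ΣFin≡sum n (f ∘ suc))

  sum-zero : ∀ {n} {f : Fin n → Carrier} → (∀ i → f i ≈ 0#) → sum f ≈ 0#
  sum-zero {n} f≈0 = trans (sum-cong-≋ f≈0) (sum-replicate-zero n)

  sum-neg : ∀ {n} (f : Fin n → Carrier) → ∑[ i < n ] (- f i) ≈ - sum f
  sum-neg {zero}  f = sym -0#≈0#
  sum-neg {suc n} f = trans (+-congˡ (sum-neg (f ∘ suc))) (-‿+-comm (f zero) _)

  sum-toℕ-last : ∀ N (g : ℕ → Carrier) →
    ∑[ m < suc N ] g (toℕ m) ≈ ∑[ m < N ] g (toℕ m) + g N
  sum-toℕ-last N g = trans (sum-init-last (g ∘ toℕ))
    (reflexive (≡.cong₂ _+_ (sum-cong-≗ {N} (≡.cong g ∘ toℕ-inject₁)) (≡.cong g (toℕ-fromℕ N))))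

module Determinant {c ℓ : Level} (R : CommutativeRing c ℓ) where
  open CommutativeRing R hiding (zero)
  open Sums R
  open import Algebra.Properties.Ring ring
    using (-‿distribˡ-*; -‿distribʳ-*; -‿involutive; -‿+-comm; -0#≈0#; +-inverseʳ-unique)
  open import Algebra.Properties.CommutativeSemigroup *-commutativeSemigroup using (x∙yz≈y∙xz)
  open import Relation.Binary.Reasoning.Setoid setoid

  sign : ∀ {n} → Fin n → Carrier
  sign j = sgn R (toℕ j)

  minor : ∀ {m n} → (Fin m → Fin (suc n) → Carrier) → Fin (suc n) → Fin m → Fin n → Carrier
  minor Rs j i k = Rs i (punchIn j k)

  cofactor : ∀ {n} → (Fin n → Fin (suc n) → Carrier) → Fin (suc n) → Carrier
  cofactor {n} Rs j = sign j * det R n (minor Rs j)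

  -- det R (suc n) only inspects M zero and M ∘ suc, so det R (suc n) M and
  -- det R (suc n) (M zero ∷ M ∘ suc) agree definitionally.
  det-cofactor-expansion : ∀ {n} (u : Fin (suc n) → Carrier) Rs →
    det R (suc n) (u ∷ Rs) ≈ ∑[ j < suc n ] (u j * cofactor Rs j)
  det-cofactor-expansion {n} u Rs =
    trans (reflexive (ΣFin≡sum (suc n) (λ j → sign j * (u j * det R n (minor Rs j)))))
          (sum-cong-≋ λ j → x∙yz≈y∙xz (sign j) (u j) (det R n (minor Rs j)))

  det-cong : ∀ n {M N : Fin n → Fin n → Carrier} → (∀ i j → M i j ≈ N i j) → det R n M ≈ det R n N
  det-cong zero    M≈N = refl
  det-cong (suc n) {M} {N} M≈N = begin
    det R (suc n) M                                   ≈⟨ det-cofactor-expansion (M zero) (M ∘ suc) ⟩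
    ∑[ j < suc n ] (M zero j * cofactor (M ∘ suc) j)   ≈⟨ sum-cong-≋ (λ j → *-cong (M≈N zero j)
                                                          (*-congˡ {sign j} (det-cong n (λ i k → M≈N (suc i) (punchIn j k))))) ⟩
    ∑[ j < suc n ] (N zero j * cofactor (N ∘ suc) j)   ≈⟨ det-cofactor-expansion (N zero) (N ∘ suc) ⟨
    det R (suc n) N                                   ∎

  det-row₀-+ : ∀ {n} (u v : Fin (suc n) → Carrier) Rs →
    det R (suc n) ((λ j → u j + v j) ∷ Rs) ≈ det R (suc n) (u ∷ Rs) + det R (suc n) (v ∷ Rs)
  det-row₀-+ {n} u v Rs = begin
    det R (suc n) ((λ j → u j + v j) ∷ Rs)            ≈⟨ det-cofactor-expansion (λ j → u j + v j) Rs ⟩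
    ∑[ j < suc n ] ((u j + v j) * C j)                ≈⟨ sum-cong-≋ (λ j → distribʳ (C j) (u j) (v j)) ⟩
    ∑[ j < suc n ] (u j * C j + v j * C j)            ≈⟨ ∑-distrib-+ (λ j → u j * C j) (λ j → v j * C j) ⟩
    ∑[ j < suc n ] (u j * C j) + ∑[ j < suc n ] (v j * C j)
                                                      ≈⟨ +-cong (det-cofactor-expansion u Rs) (det-cofactor-expansion v Rs) ⟨
    det R (suc n) (u ∷ Rs) + det R (suc n) (v ∷ Rs)   ∎
    where C = cofactor Rs

  det-row₀-∑ : ∀ {n N} (β : Fin N → Carrier) (r : Fin N → Fin (suc n) → Carrier) Rs →
    det R (suc n) ((λ j → ∑[ m < N ] (β m * r m j)) ∷ Rs) ≈ ∑[ m < N ] (β m * det R (suc n) (r m ∷ Rs))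
  det-row₀-∑ {n} {N} β r Rs = begin
    det R (suc n) ((λ j → ∑[ m < N ] (β m * r m j)) ∷ Rs)
      ≈⟨ det-cofactor-expansion (λ j → ∑[ m < N ] (β m * r m j)) Rs ⟩
    ∑[ j < suc n ] ((∑[ m < N ] (β m * r m j)) * C j)
      ≈⟨ sum-cong-≋ (λ j → trans (*-distribʳ-sum (C j) (λ m → β m * r m j))
                                 (sum-cong-≋ λ m → *-assoc (β m) (r m j) (C j))) ⟩
    ∑[ j < suc n ] ∑[ m < N ] (β m * (r m j * C j))
      ≈⟨ ∑-comm (λ j m → β m * (r m j * C j)) ⟩
    ∑[ m < N ] ∑[ j < suc n ] (β m * (r m j * C j))
      ≈⟨ sum-cong-≋ (λ m → *-distribˡ-sum (β m) (λ j → r m j * C j)) ⟨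
    ∑[ m < N ] (β m * ∑[ j < suc n ] (r m j * C j))
      ≈⟨ sum-cong-≋ (λ m → *-congˡ (det-cofactor-expansion (r m) Rs)) ⟨
    ∑[ m < N ] (β m * det R (suc n) (r m ∷ Rs)) ∎
    where C = cofactor Rs

  det-row₀-zero : ∀ {n} {u : Fin (suc n) → Carrier} Rs → (∀ j → u j ≈ 0#) → det R (suc n) (u ∷ Rs) ≈ 0#
  det-row₀-zero {u = u} Rs u≈0 = trans (det-cofactor-expansion u Rs)
    (sum-zero λ j → trans (*-congʳ (u≈0 j)) (zeroˡ (cofactor Rs j)))

  det-row₁-+ : ∀ {n} (u v w : Fin (suc (suc n)) → Carrier) Rs →
    det R (suc (suc n)) (u ∷ (λ j → v j + w j) ∷ Rs) ≈
    det R (suc (suc n)) (u ∷ v ∷ Rs) + det R (suc (suc n)) (u ∷ w ∷ Rs)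
  det-row₁-+ {n} u v w Rs = begin
    det R (suc (suc n)) (u ∷ (λ j → v j + w j) ∷ Rs)
      ≈⟨ det-cofactor-expansion u ((λ j → v j + w j) ∷ Rs) ⟩
    ∑[ j < suc (suc n) ] (u j * cofactor ((λ j → v j + w j) ∷ Rs) j)
      ≈⟨ sum-cong-≋ (λ j → *-congˡ {u j} (trans (*-congˡ (det-row₀-+ (v ∘ punchIn j) (w ∘ punchIn j) (minor Rs j)))
                                          (distribˡ (sign j) _ _))) ⟩
    ∑[ j < suc (suc n) ] (u j * (cofactor (v ∷ Rs) j + cofactor (w ∷ Rs) j))
      ≈⟨ sum-cong-≋ (λ j → distribˡ (u j) (cofactor (v ∷ Rs) j) (cofactor (w ∷ Rs) j)) ⟩
    ∑[ j < suc (suc n) ] (u j * cofactor (v ∷ Rs) j + u j * cofactor (w ∷ Rs) j)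
      ≈⟨ ∑-distrib-+ (λ j → u j * cofactor (v ∷ Rs) j) (λ j → u j * cofactor (w ∷ Rs) j) ⟩
    ∑[ j < suc (suc n) ] (u j * cofactor (v ∷ Rs) j) +
    ∑[ j < suc (suc n) ] (u j * cofactor (w ∷ Rs) j)
      ≈⟨ +-cong (det-cofactor-expansion u (v ∷ Rs)) (det-cofactor-expansion u (w ∷ Rs)) ⟨
    det R (suc (suc n)) (u ∷ v ∷ Rs) + det R (suc (suc n)) (u ∷ w ∷ Rs) ∎

  x*[-y*z]≈-[x*[y*z]] : ∀ x y z → x * (- y * z) ≈ - (x * (y * z))
  x*[-y*z]≈-[x*[y*z]] x y z = trans (*-congˡ (sym (-‿distribˡ-* y z))) (sym (-‿distribʳ-* x (y * z)))

  x*[y*-z]≈-[x*[y*z]] : ∀ x y z → x * (y * - z) ≈ - (x * (y * z))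
  x*[y*-z]≈-[x*[y*z]] x y z = trans (*-congˡ (sym (-‿distribʳ-* y z))) (sym (-‿distribʳ-* x (y * z)))

  -- Expanding det (u ∷ u ∷ Rs) along both first rows; D g is the complementary minor on the columns g.
  pairExpansion : ∀ {n} → (Fin (suc (suc n)) → Carrier) → ((Fin n → Fin (suc (suc n))) → Carrier) →
    Carrier
  pairExpansion {n} u D =
    ∑[ j < suc (suc n) ] (u j * (sign j *
      ∑[ k < suc n ] (u (punchIn j k) * (sign k * D (punchIn j ∘ punchIn k)))))

  pairsAvoiding0 : ∀ {n} → (Fin (suc (suc n)) → Carrier) → ((Fin n → Fin (suc (suc n))) → Carrier) →
    Carrier
  pairsAvoiding0 {n} u D =
    ∑[ j < suc n ] (u (suc j) * (sign j *
      ∑[ k < n ] (u (suc (punchIn j k)) * (sign k * D (punchIn (suc j) ∘ punchIn (suc k))))))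

  -- The pairs of columns containing column 0 cancel: (0, suc j) against (suc j, 0).
  pairExpansion≈pairsAvoiding0 : ∀ {n} u D → pairExpansion {n} u D ≈ pairsAvoiding0 u D
  pairExpansion≈pairsAvoiding0 {n} u D = begin
    pairExpansion u D
      ≡⟨⟩
    u zero * (1# * A) + ∑[ j < suc n ] (u (suc j) * (- sign j * (u zero * (1# * E j) + Y j)))
      ≈⟨ +-cong (*-congˡ (*-identityˡ A)) (sum-cong-≋ term) ⟩
    u zero * A + ∑[ j < suc n ] (- (u zero * G j) + W j)
      ≈⟨ +-congˡ (∑-distrib-+ (λ j → - (u zero * G j)) W) ⟩
    u zero * A + (∑[ j < suc n ] (- (u zero * G j)) + sum W)
      ≈⟨ +-congˡ (+-congʳ (trans (sum-neg (λ j → u zero * G j)) (-‿cong (sym (*-distribˡ-sum (u zero) G))))) ⟩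
    u zero * A + (- (u zero * A) + sum W)
      ≈⟨ +-assoc _ _ _ ⟨
    (u zero * A + - (u zero * A)) + sum W
      ≈⟨ +-congʳ (-‿inverseʳ _) ⟩
    0# + sum W
      ≈⟨ +-identityˡ _ ⟩
    sum W ∎
    where
    E : Fin (suc n) → Carrier
    E j = D (suc ∘ punchIn j)
    G : Fin (suc n) → Carrier
    G j = u (suc j) * (sign j * E j)
    A : Carrier
    A = sum G
    v : Fin (suc n) → Fin n → Carrier
    v j k = u (suc (punchIn j k))
    d : Fin (suc n) → Fin n → Carrier
    d j k = D (punchIn (suc j) ∘ punchIn (suc k))
    Y′ : Fin (suc n) → Carrier
    Y′ j = ∑[ k < n ] (v j k * (sign k * d j k))
    Y : Fin (suc n) → Carrier
    Y j = ∑[ k < n ] (v j k * (- sign k * d j k))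
    W : Fin (suc n) → Carrier
    W j = u (suc j) * (sign j * Y′ j)
    Y≈-Y′ : ∀ j → Y j ≈ - Y′ j
    Y≈-Y′ j = trans (sum-cong-≋ λ k → x*[-y*z]≈-[x*[y*z]] (v j k) (sign k) (d j k))
                    (sum-neg λ k → v j k * (sign k * d j k))
    term : ∀ j → u (suc j) * (- sign j * (u zero * (1# * E j) + Y j)) ≈ - (u zero * G j) + W j
    term j = begin
      u (suc j) * (- sign j * (u zero * (1# * E j) + Y j))
        ≈⟨ x*[-y*z]≈-[x*[y*z]] (u (suc j)) (sign j) _ ⟩
      - (u (suc j) * (sign j * (u zero * (1# * E j) + Y j)))
        ≈⟨ -‿cong (trans (*-congˡ (distribˡ (sign j) _ (Y j))) (distribˡ (u (suc j)) _ _)) ⟩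
      - (u (suc j) * (sign j * (u zero * (1# * E j))) + u (suc j) * (sign j * Y j))
        ≈⟨ -‿+-comm _ _ ⟨
      - (u (suc j) * (sign j * (u zero * (1# * E j)))) + - (u (suc j) * (sign j * Y j))
        ≈⟨ +-cong (-‿cong pull-u₀) (-‿cong (*-congˡ (*-congˡ (Y≈-Y′ j)))) ⟩
      - (u zero * G j) + - (u (suc j) * (sign j * - Y′ j))
        ≈⟨ +-congˡ (trans (-‿cong (x*[y*-z]≈-[x*[y*z]] _ _ _)) (-‿involutive _)) ⟩
      - (u zero * G j) + W j ∎
      where
      pull-u₀ : u (suc j) * (sign j * (u zero * (1# * E j))) ≈ u zero * G j
      pull-u₀ = trans (*-congˡ (trans (*-congˡ (*-congˡ (*-identityˡ (E j)))) (x∙yz≈y∙xz (sign j) (u zero) (E j))))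
                      (x∙yz≈y∙xz (u (suc j)) (u zero) _)

  pairExpansion-vanishes : ∀ {n} u (D : (Fin n → Fin (suc (suc n))) → Carrier) →
    (∀ {g h} → g ≗ h → D g ≈ D h) → pairExpansion u D ≈ 0#
  pairExpansion-vanishes {zero} u D D-ext = trans (pairExpansion≈pairsAvoiding0 u D)
    (sum-zero λ j → trans (*-congˡ (zeroʳ (sign j))) (zeroʳ (u (suc j))))
  pairExpansion-vanishes {suc n} u D D-ext = begin
    pairExpansion u D              ≈⟨ pairExpansion≈pairsAvoiding0 u D ⟩
    pairsAvoiding0 u D             ≈⟨ sum-cong-≋ (λ j → *-congˡ {u (suc j)} (*-congˡ {sign j}
                                        (sum-cong-≋ λ k → *-congˡ {u (suc (punchIn j k))} (*-congˡ {sign k}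
                                          (D-ext (punchIn-suc∘punchIn-suc j k)))))) ⟩
    pairExpansion (u ∘ suc) D′     ≈⟨ pairExpansion-vanishes (u ∘ suc) D′ D′-ext ⟩
    0#                             ∎
    where
    D′ : (Fin n → Fin (suc (suc n))) → Carrier
    D′ = D ∘ lift 1
    D′-ext : ∀ {g h} → g ≗ h → D′ g ≈ D′ h
    D′-ext g≗h = D-ext λ { zero → ≡.refl ; (suc l) → ≡.cong suc (g≗h l) }
    punchIn-suc∘punchIn-suc : ∀ j k → punchIn (suc j) ∘ punchIn (suc k) ≗ lift 1 (punchIn j ∘ punchIn k)
    punchIn-suc∘punchIn-suc j k zero    = ≡.refl
    punchIn-suc∘punchIn-suc j k (suc l) = ≡.refl

  det-row₀≈row₁ : ∀ {n} (u : Fin (suc (suc n)) → Carrier) Rs → det R (suc (suc n)) (u ∷ u ∷ Rs) ≈ 0#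
  det-row₀≈row₁ {n} u Rs = begin
    det R (suc (suc n)) (u ∷ u ∷ Rs)
      ≈⟨ det-cofactor-expansion u (u ∷ Rs) ⟩
    ∑[ j < suc (suc n) ] (u j * cofactor (u ∷ Rs) j)
      ≈⟨ sum-cong-≋ (λ j → *-congˡ {u j} (*-congˡ {sign j} (det-cofactor-expansion (u ∘ punchIn j) (minor Rs j)))) ⟩
    pairExpansion u D
      ≈⟨ pairExpansion-vanishes u D (λ g≗h → det-cong n λ i l → reflexive (≡.cong (Rs i) (g≗h l))) ⟩
    0# ∎
    where
    D : (Fin n → Fin (suc (suc n))) → Carrier
    D g = det R n (λ i l → Rs i (g l))

  det-swap-row₀-row₁ : ∀ {n} (u v : Fin (suc (suc n)) → Carrier) Rs →
    det R (suc (suc n)) (v ∷ u ∷ Rs) ≈ - det R (suc (suc n)) (u ∷ v ∷ Rs)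
  det-swap-row₀-row₁ {n} u v Rs = +-inverseʳ-unique (d u v) (d v u) (begin
    d u v + d v u                        ≈⟨ +-cong (+-identityˡ _) (+-identityʳ _) ⟨
    (0# + d u v) + (d v u + 0#)          ≈⟨ +-cong (+-congʳ (det-row₀≈row₁ u Rs)) (+-congˡ (det-row₀≈row₁ v Rs)) ⟨
    (d u u + d u v) + (d v u + d v v)    ≈⟨ +-cong (det-row₁-+ u u v Rs) (det-row₁-+ v u v Rs) ⟨
    d u w + d v w                        ≈⟨ det-row₀-+ u v (w ∷ Rs) ⟨
    d w w                                ≈⟨ det-row₀≈row₁ w Rs ⟩
    0#                                   ∎)
    where
    d : (Fin (suc (suc n)) → Carrier) → (Fin (suc (suc n)) → Carrier) → Carrier
    d x y = det R (suc (suc n)) (x ∷ y ∷ Rs)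
    w : Fin (suc (suc n)) → Carrier
    w j = u j + v j

  det-equal-rows : ∀ {n} (M : Fin (suc n) → Fin (suc n) → Carrier) (s : Fin n) →
    (∀ j → M zero j ≈ M (suc s) j) → det R (suc n) M ≈ 0#
  det-equal-rows {suc n} M zero M₀≈M₁ = begin
    det R (suc (suc n)) M                        ≈⟨ det-cong (suc (suc n)) rows ⟩
    det R (suc (suc n)) (M zero ∷ M zero ∷ Rs)   ≈⟨ det-row₀≈row₁ (M zero) Rs ⟩
    0#                                           ∎
    where
    Rs : Fin n → Fin (suc (suc n)) → Carrier
    Rs i = M (suc (suc i))
    rows : ∀ i j → M i j ≈ (M zero ∷ M zero ∷ Rs) i j
    rows zero          j = refl
    rows (suc zero)    j = sym (M₀≈M₁ j)
    rows (suc (suc i)) j = refl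
  -- After swapping rows 0 and 1, every minor along the new first row has two equal rows.
  det-equal-rows {suc n} M (suc s) M₀≈Mₛ = begin
    det R (suc (suc n)) M                         ≈⟨ -‿involutive _ ⟨
    - - det R (suc (suc n)) M                     ≈⟨ -‿cong (det-swap-row₀-row₁ (M zero) (M (suc zero)) Rs) ⟨
    - det R (suc (suc n)) (M (suc zero) ∷ M zero ∷ Rs)
      ≈⟨ -‿cong (trans (det-cofactor-expansion (M (suc zero)) (M zero ∷ Rs)) (sum-zero minors-vanish)) ⟩
    - 0#                                          ≈⟨ -0#≈0# ⟩
    0#                                            ∎
    where
    Rs : Fin n → Fin (suc (suc n)) → Carrier
    Rs i = M (suc (suc i))
    minors-vanish : ∀ j → M (suc zero) j * cofactor (M zero ∷ Rs) j ≈ 0#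
    minors-vanish j = trans
      (*-congˡ (trans (*-congˡ (det-equal-rows (minor (M zero ∷ Rs) j) s (M₀≈Mₛ ∘ punchIn j))) (zeroʳ (sign j))))
      (zeroʳ (M (suc zero) j))

module FactorialPowers {c ℓ : Level} (R : CommutativeRing c ℓ) where
  open CommutativeRing R hiding (zero)
  open Sums R
  open import Algebra.Solver.Ring.NaturalCoefficients.Default commutativeSemiring using (solve; _:=_; _:+_; _:*_)
  open import Relation.Binary.Reasoning.Setoid setoid

  τ-τ-inverse : ∀ r b n → τ R r (τ R (ℤ.- r) b) n ≡ b n
  τ-τ-inverse r b n = ≡.cong b (≡.trans (ℤP.+-assoc n r (ℤ.- r))
    (≡.trans (≡.cong (λ z → n ℤ.+ z) (ℤP.+-inverseʳ r)) (ℤP.+-identityʳ n)))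

  fpow-cong : ∀ y {b b′ : ℤ → Carrier} m → (∀ n → b n ≡ b′ n) → fpow R y b m ≡ fpow R y b′ m
  fpow-cong y zero    b≗b′ = ≡.refl
  fpow-cong y (suc m) b≗b′ = ≡.cong₂ (λ f z → f * (y - z)) (fpow-cong y m b≗b′) (b≗b′ (+ suc m))

  fpow-+ : ∀ y b d m → fpow R y b (d ℕ.+ m) ≈ fpow R y b d * fpow R y (τ R (+ d) b) m
  fpow-+ y b d zero rewrite ℕP.+-identityʳ d = sym (*-identityʳ _)
  fpow-+ y b d (suc m) rewrite ℕP.+-suc d m = begin
    fpow R y b (d ℕ.+ m) * (y - b (+ suc (d ℕ.+ m)))
      ≈⟨ *-cong (fpow-+ y b d m) (reflexive (≡.cong (λ n → y - b (+ suc n)) (ℕP.+-comm d m))) ⟩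
    (fpow R y b d * fpow R y (τ R (+ d) b) m) * (y - b (+ suc (m ℕ.+ d)))
      ≈⟨ *-assoc _ _ _ ⟩
    fpow R y b d * fpow R y (τ R (+ d) b) (suc m) ∎

  y-x≈[y-z]+[z-x] : ∀ x y z → y - x ≈ (y - z) + (z - x)
  y-x≈[y-z]+[z-x] x y z = sym (begin
    (y - z) + (z - x)     ≈⟨ +-assoc y (- z) (z - x) ⟩
    y + (- z + (z - x))   ≈⟨ +-congˡ (+-assoc (- z) z (- x)) ⟨
    y + ((- z + z) - x)   ≈⟨ +-congˡ (+-congʳ (-‿inverseˡ z)) ⟩
    y + (0# - x)          ≈⟨ +-congˡ (+-identityˡ (- x)) ⟩
    y - x                 ∎)

  module Expansion (a : ℤ → Carrier) where

    expand : ℕ → (ℕ → Carrier) → Carrier → Carrier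
    expand N cf y = ∑[ m < N ] (cf (toℕ m) * fpow R y a (toℕ m))

    expand-suc : ∀ N cf y → expand (suc N) cf y ≈ expand N cf y + cf N * fpow R y a N
    expand-suc N cf y = sum-toℕ-last N (λ m → cf m * fpow R y a m)

    -- Multiplication by (y - x), using (y - x)(y|a)^m = (y|a)^(m+1) + (a_(m+1) - x)(y|a)^m.
    mulLinear : Carrier → (ℕ → Carrier) → ℕ → Carrier
    mulLinear x cf zero    = (a (+ 1) - x) * cf zero
    mulLinear x cf (suc m) = cf m + (a (+ suc (suc m)) - x) * cf (suc m)

    expand-mulLinear : ∀ N x cf y →
      expand (suc N) (mulLinear x cf) y ≈ expand N cf y * (y - x) + ((a (+ suc N) - x) * cf N) * fpow R y a N
    expand-mulLinear zero x cf y =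
      trans (+-identityʳ _) (sym (trans (+-congʳ (zeroˡ (y - x))) (+-identityˡ _)))
    expand-mulLinear (suc N) x cf y = begin
      expand (suc (suc N)) (mulLinear x cf) y
        ≈⟨ expand-suc (suc N) (mulLinear x cf) y ⟩
      expand (suc N) (mulLinear x cf) y + (cf N + b * cf (suc N)) * (F * p)
        ≈⟨ +-congʳ (expand-mulLinear N x cf y) ⟩
      (E * (y - x) + (q * cf N) * F) + (cf N + b * cf (suc N)) * (F * p)
        ≈⟨ +-congʳ (+-congʳ (*-congˡ (y-x≈[y-z]+[z-x] x y (a (+ suc N))))) ⟩
      (E * (p + q) + (q * cf N) * F) + (cf N + b * cf (suc N)) * (F * p)
        ≈⟨ solve 7 (λ E p q c F b d → ((E :* (p :+ q) :+ (q :* c) :* F) :+ (c :+ b :* d) :* (F :* p))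
                                      := ((E :+ c :* F) :* (p :+ q) :+ (b :* d) :* (F :* p)))
                   refl E p q (cf N) F b (cf (suc N)) ⟩
      (E + cf N * F) * (p + q) + (b * cf (suc N)) * (F * p)
        ≈⟨ +-congʳ (*-cong (expand-suc N cf y) (y-x≈[y-z]+[z-x] x y (a (+ suc N)))) ⟨
      expand (suc N) cf y * (y - x) + (b * cf (suc N)) * fpow R y a (suc N) ∎
      where
      E = expand N cf y
      F = fpow R y a N
      p = y - a (+ suc N)
      q = a (+ suc N) - x
      b = a (+ suc (suc N)) - x

    -- productCoeff q xs m is the coefficient of (y|a)^m in ∏ₗ (y - xs l).
    productCoeff : (q : ℕ) → (Fin q → Carrier) → ℕ → Carrier
    productCoeff zero    xs zero    = 1#
    productCoeff zero    xs (suc m) = 0#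
    productCoeff (suc q) xs         = mulLinear (xs zero) (productCoeff q (xs ∘ suc))

    productCoeff-above : ∀ q xs m → q ℕ.< m → productCoeff q xs m ≈ 0#
    productCoeff-above zero    xs (suc m) _          = refl
    productCoeff-above (suc q) xs (suc m) (ℕ.s≤s q<m) = trans
      (+-cong (productCoeff-above q (xs ∘ suc) m q<m)
              (trans (*-congˡ (productCoeff-above q (xs ∘ suc) (suc m) (ℕP.m<n⇒m<1+n q<m))) (zeroʳ _)))
      (+-identityʳ 0#)

    productCoeff-top : ∀ q xs → productCoeff q xs q ≈ 1#
    productCoeff-top zero    xs = refl
    productCoeff-top (suc q) xs = trans
      (+-cong (productCoeff-top q (xs ∘ suc))
              (trans (*-congˡ (productCoeff-above q (xs ∘ suc) (suc q) ℕP.≤-refl)) (zeroʳ _)))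
      (+-identityʳ 1#)

    expand-productCoeff-suc : ∀ q xs y →
      expand (suc (suc q)) (productCoeff (suc q) xs) y ≈ expand (suc q) (productCoeff q (xs ∘ suc)) y * (y - xs zero)
    expand-productCoeff-suc q xs y = trans (expand-mulLinear (suc q) (xs zero) (productCoeff q (xs ∘ suc)) y)
      (trans (+-congˡ (trans (*-congʳ (trans (*-congˡ (productCoeff-above q (xs ∘ suc) (suc q) ℕP.≤-refl)) (zeroʳ _)))
                             (zeroˡ _)))
             (+-identityʳ _))

    expand-productCoeff-root : ∀ q xs (j : Fin q) → expand (suc q) (productCoeff q xs) (xs j) ≈ 0#
    expand-productCoeff-root (suc q) xs zero = trans (expand-productCoeff-suc q xs (xs zero))
      (trans (*-congˡ (-‿inverseʳ (xs zero))) (zeroʳ _))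
    expand-productCoeff-root (suc q) xs (suc j) = trans (expand-productCoeff-suc q xs (xs (suc j)))
      (trans (*-congʳ (expand-productCoeff-root q (xs ∘ suc) j)) (zeroˡ _))

[1+c]-[[1+q]-m]≡[c+m]-q : ∀ c q m → (+ 1 ℤ.+ c) ℤ.- ((+ 1 ℤ.+ q) ℤ.- m) ≡ (c ℤ.+ m) ℤ.- q
[1+c]-[[1+q]-m]≡[c+m]-q = solve-∀

module HMatrix {c ℓ : Level} (R : CommutativeRing c ℓ) where
  open CommutativeRing R hiding (zero)
  open Sums R
  open Determinant R
  open FactorialPowers R
  open import Algebra.Properties.CommutativeSemigroup *-commutativeSemigroup using (x∙yz≈y∙xz)
  open import Relation.Binary.Reasoning.Setoid setoid

  module _ (p′ : ℕ) (x : Fin (suc p′) → Carrier) (a : ℤ → Carrier)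
    (denom-cancel : ∀ b u → u * denom R (suc p′) x b ≈ 0# → u ≈ 0#)
    (H : ℕ → (ℤ → Carrier) → Carrier)
    (H-denom : ∀ k b → H k b * denom R (suc p′) x b ≈ numer R (suc p′) k x b) where

    open Expansion a

    p : ℕ
    p = suc p′

    powerRow : (ℤ → Carrier) → ℕ → Fin p → Carrier
    powerRow b e j = fpow R (x j) b e

    -- denom R p x b is definitionally det R p (powerRow b p′ ∷ lowerRows b), and numer R p k x b
    -- is det R p (powerRow b (k + p′) ∷ lowerRows b).
    lowerRows : (ℤ → Carrier) → Fin p′ → Fin p → Carrier
    lowerRows b i = powerRow b (p′ ∸ suc (toℕ i))

    hZ-denom : ∀ b e → hZ R H (+ e ℤ.- + p′) b * denom R p x b ≈ det R p (powerRow b e ∷ lowerRows b)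
    hZ-denom b e with p′ ℕ.≤? e
    ... | yes p′≤e = begin
      hZ R H (+ e ℤ.- + p′) b * denom R p x b
        ≡⟨ ≡.cong (λ z → hZ R H z b * denom R p x b) (≡.trans (ℤP.[+m]-[+n]≡m⊖n e p′) (ℤP.⊖-≥ p′≤e)) ⟩
      H (e ∸ p′) b * denom R p x b
        ≈⟨ H-denom (e ∸ p′) b ⟩
      det R p (powerRow b (e ∸ p′ ℕ.+ p′) ∷ lowerRows b)
        ≡⟨ ≡.cong (λ e′ → det R p (powerRow b e′ ∷ lowerRows b)) (ℕP.m∸n+n≡m p′≤e) ⟩
      det R p (powerRow b e ∷ lowerRows b) ∎
    ... | no p′≰e = begin
      hZ R H (+ e ℤ.- + p′) b * denom R p x b
        ≡⟨ ≡.cong (λ z → hZ R H z b * denom R p x b) negative ⟩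
      0# * denom R p x b
        ≈⟨ zeroˡ _ ⟩
      0#
        ≈⟨ det-equal-rows (powerRow b e ∷ lowerRows b) s (λ j → reflexive (≡.cong (λ e′ → powerRow b e′ j) e≡)) ⟨
      det R p (powerRow b e ∷ lowerRows b) ∎
      where
      e<p′ : e < p′
      e<p′ = ℕP.≰⇒> p′≰e
      negative : + e ℤ.- + p′ ≡ -[1+ p′ ∸ suc e ]
      negative = ≡.trans (ℤP.[+m]-[+n]≡m⊖n e p′)
        (≡.trans (ℤP.⊖-< e<p′) (≡.cong (λ n → ℤ.- (+ n)) (ℕP.+-∸-assoc 1 e<p′)))
      s : Fin p′
      s = opposite (fromℕ< e<p′)
      e≡ : e ≡ p′ ∸ suc (toℕ s)
      e≡ = ≡.sym (≡.trans (≡.sym (opposite-prop s)) (≡.trans (≡.cong toℕ (opposite-involutive _)) (toℕ-fromℕ< e<p′)))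

    entry : ℕ → ℕ → Carrier
    entry i col = hZ R H ((+ 1 ℤ.+ + col) ℤ.- + i) (τ R (ℤ.- (+ col)) a)

    entry-index : ∀ col m → m ≤ p → (+ 1 ℤ.+ + col) ℤ.- + (p ∸ m) ≡ + (col ℕ.+ m) ℤ.- + p′
    entry-index col m m≤p = ≡.trans
      (≡.cong (λ z → (+ 1 ℤ.+ + col) ℤ.- z) (≡.sym (≡.trans (ℤP.[+m]-[+n]≡m⊖n p m) (ℤP.⊖-≥ m≤p))))
      ([1+c]-[[1+q]-m]≡[c+m]-q (+ col) (+ p′) (+ m))

    coeff : ℕ → Carrier
    coeff = productCoeff p x

    shifted-root : ∀ col j → ∑[ m < suc p ] (coeff (toℕ m) * powerRow (τ R (ℤ.- (+ col)) a) (col ℕ.+ toℕ m) j) ≈ 0#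
    shifted-root col j = begin
      ∑[ m < suc p ] (coeff (toℕ m) * fpow R (x j) b (col ℕ.+ toℕ m))
        ≈⟨ sum-cong-≋ {suc p} (λ m → *-congˡ {coeff (toℕ m)} (trans (fpow-+ (x j) b col (toℕ m))
                                            (*-congˡ (reflexive (fpow-cong (x j) (toℕ m) (τ-τ-inverse (+ col) a)))))) ⟩
      ∑[ m < suc p ] (coeff (toℕ m) * (fpow R (x j) b col * fpow R (x j) a (toℕ m)))
        ≈⟨ sum-cong-≋ {suc p} (λ m → x∙yz≈y∙xz (coeff (toℕ m)) (fpow R (x j) b col) (fpow R (x j) a (toℕ m))) ⟩
      ∑[ m < suc p ] (fpow R (x j) b col * (coeff (toℕ m) * fpow R (x j) a (toℕ m)))
        ≈⟨ *-distribˡ-sum {suc p} (fpow R (x j) b col) (λ m → coeff (toℕ m) * fpow R (x j) a (toℕ m)) ⟨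
      fpow R (x j) b col * expand (suc p) coeff (x j)
        ≈⟨ *-congˡ (expand-productCoeff-root p x j) ⟩
      fpow R (x j) b col * 0#
        ≈⟨ zeroʳ _ ⟩
      0# ∎
      where
      b = τ R (ℤ.- (+ col)) a

    column-relation : ∀ col → ∑[ m < suc p ] (coeff (toℕ m) * entry (p ∸ toℕ m) col) ≈ 0#
    column-relation col = denom-cancel b _ (begin
      ∑[ m < suc p ] (coeff (toℕ m) * entry (p ∸ toℕ m) col) * denom R p x b
        ≈⟨ *-distribʳ-sum {suc p} (denom R p x b) (λ m → coeff (toℕ m) * entry (p ∸ toℕ m) col) ⟩
      ∑[ m < suc p ] (coeff (toℕ m) * entry (p ∸ toℕ m) col * denom R p x b)
        ≈⟨ sum-cong-≋ {suc p} (λ m → trans (*-assoc (coeff (toℕ m)) (entry (p ∸ toℕ m) col) (denom R p x b))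
                                           (*-congˡ (entry-denom (toℕ m) (ℕ.s≤s⁻¹ (toℕ<n m))))) ⟩
      ∑[ m < suc p ] (coeff (toℕ m) * det R p (powerRow b (col ℕ.+ toℕ m) ∷ lowerRows b))
        ≈⟨ det-row₀-∑ {N = suc p} (coeff ∘ toℕ) (λ m → powerRow b (col ℕ.+ toℕ m)) (lowerRows b) ⟨
      det R p ((λ j → ∑[ m < suc p ] (coeff (toℕ m) * powerRow b (col ℕ.+ toℕ m) j)) ∷ lowerRows b)
        ≈⟨ det-row₀-zero (lowerRows b) (shifted-root col) ⟩
      0# ∎)
      where
      b = τ R (ℤ.- (+ col)) a
      entry-denom : ∀ m → m ≤ p → entry (p ∸ m) col * denom R p x b ≈ det R p (powerRow b (col ℕ.+ m) ∷ lowerRows b)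
      entry-denom m m≤p =
        trans (*-congʳ (reflexive (≡.cong (λ z → hZ R H z b) (entry-index col m m≤p)))) (hZ-denom b (col ℕ.+ m))

    det-vanishes : ∀ k′ → p ≤ k′ → det R (suc k′) (λ i j → entry (toℕ i) (toℕ j)) ≈ 0#
    det-vanishes k′ p≤k′ = begin
      det R (suc k′) (λ i j → entry (toℕ i) (toℕ j))
        ≈⟨ det-cong (suc k′) first-row ⟩
      det R (suc k′) (row p ∷ Rs)
        ≈⟨ trans (*-congʳ (productCoeff-top p x)) (*-identityˡ _) ⟨
      coeff p * det R (suc k′) (row p ∷ Rs)
        ≈⟨ trans (+-congʳ (sum-zero lower-terms)) (+-identityˡ _) ⟨
      ∑[ m < p ] (coeff (toℕ m) * det R (suc k′) (row (toℕ m) ∷ Rs)) + coeff p * det R (suc k′) (row p ∷ Rs)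
        ≈⟨ sum-toℕ-last p (λ m → coeff m * det R (suc k′) (row m ∷ Rs)) ⟨
      ∑[ m < suc p ] (coeff (toℕ m) * det R (suc k′) (row (toℕ m) ∷ Rs))
        ≈⟨ det-row₀-∑ {N = suc p} (coeff ∘ toℕ) (row ∘ toℕ) Rs ⟨
      det R (suc k′) ((λ j → ∑[ m < suc p ] (coeff (toℕ m) * row (toℕ m) j)) ∷ Rs)
        ≈⟨ det-row₀-zero Rs (column-relation ∘ toℕ) ⟩
      0# ∎
      where
      row : ℕ → Fin (suc k′) → Carrier
      row m j = entry (p ∸ m) (toℕ j)
      Rs : Fin k′ → Fin (suc k′) → Carrier
      Rs i j = entry (suc (toℕ i)) (toℕ j)
      first-row : ∀ i j → entry (toℕ i) (toℕ j) ≈ (row p ∷ Rs) i j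
      first-row zero    j = reflexive (≡.cong (λ i → entry i (toℕ j)) (≡.sym (ℕP.n∸n≡0 p)))
      first-row (suc i) j = refl
      lower-terms : ∀ (m : Fin p) → coeff (toℕ m) * det R (suc k′) (row (toℕ m) ∷ Rs) ≈ 0#
      lower-terms m = trans (*-congˡ (det-equal-rows (row (toℕ m) ∷ Rs) s
          (λ j → reflexive (≡.cong (λ i → entry i (toℕ j)) p∸m≡1+s)))) (zeroʳ _)
        where
        s<k′ : p′ ∸ toℕ m < k′
        s<k′ = ℕP.≤-<-trans (ℕP.m∸n≤m p′ (toℕ m)) p≤k′
        s : Fin k′
        s = fromℕ< s<k′
        p∸m≡1+s : p ∸ toℕ m ≡ suc (toℕ s)
        p∸m≡1+s = ≡.trans (ℕP.+-∸-assoc 1 (ℕ.s≤s⁻¹ (toℕ<n m))) (≡.cong suc (≡.sym (toℕ-fromℕ< s<k′)))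

proposition2p4 : {c ℓ : Level} (R : CommutativeRing c ℓ) →
    let open CommutativeRing R in
    (p : ℕ) → 1 ≤ p → (x : Fin p → Carrier) → (a : ℤ → Carrier) →
    (∀ (b : ℤ → Carrier) (u : Carrier) → u * denom R p x b ≈ 0# → u ≈ 0#) →
    (H : ℕ → (ℤ → Carrier) → Carrier) →
    (∀ (k : ℕ) (b : ℤ → Carrier) → H k b * denom R p x b ≈ numer R p k x b) →
    (k : ℕ) → p < k →
    det R k (λ i j → hZ R H ((+ 1 ℤ.+ + toℕ j) ℤ.- + toℕ i) (τ R (ℤ.- (+ toℕ j)) a)) ≈ 0#
proposition2p4 R (suc p′) _ x a denom-cancel H H-denom (suc k′) p<k =
  HMatrix.det-vanishes R p′ x a denom-cancel H H-denom k′ (ℕ.s≤s⁻¹ p<k)
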